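{- For atomic steps $a,b$ and commands $c,d$: $a^\star;c \otimes b^\star;d = (a\otimes b)^\star;\big((c \otimes b^\star;d) \sqcap (a^\star;c \otimes d)\big)$.
   Context: Commands form a complete distributive lattice under refinement with nondeterministic choice $\sqcap$; sequential composition $;$ (binding tighter than $\otimes$) is associative with identity $\mathbf{nil}$, distributes over arbitrary choices on the right and over non-empty choices on the left. Finite iteration is $c^\star = \nu x.\,\mathbf{nil}\sqcap c;x$, so that $c^\star = \sqcap_{i\in\mathbb{N}} c^i$ with $c^0=\mathbf{nil}$, $c^{i+1}=c;c^i$. A synchronisation operator $\otimes$ is associative, commutative, distributes over non-empty nondeterministic choices, is closed on atomic steps, and satisfies $(a;c)\otimes(b;d) = (a\otimes b);(c\otimes d)$ for atomic $a,b$ (hence $a^i;c\otimes b^i;d = (a\otimes b)^i;(c\otimes d)$). -}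

module Defs where

open import Level using (Level; suc; _⊔_)
open import Data.Nat using (ℕ; zero) renaming (suc to sucℕ)
open import Data.Product using (Σ; _×_; _,_; proj₁)
open import Relation.Binary.PropositionalEquality using (_≡_)

-- Command algebra: a complete distributive lattice of commands under
-- refinement _≽_ (c ≽ d : "c is refined by d"), with arbitrary
-- nondeterministic choice ⨅ (the meet / infimum), binary choice _⊓_,
-- sequential composition _；_ with identity nil, atomic steps (a
-- predicate on commands), and a synchronisation operator _⊗_.
record CommandAlgebra (c : Level) : Set (suc c) where
  infixr 7 _；_
  infixr 6 _⊗_
  infixr 5 _⊓_
  infix 9 _⋆
  field
    Cmd    : Set c
    _≽_    : Cmd → Cmd → Set c
    ≽-refl    : ∀ {x} → x ≽ x
    ≽-trans   : ∀ {x y z} → x ≽ y → y ≽ z → x ≽ z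
    ≽-antisym : ∀ {x y} → x ≽ y → y ≽ x → x ≡ y
    ⨅        : {I : Set c} → (I → Cmd) → Cmd
    ⨅-lower  : ∀ {I : Set c} (f : I → Cmd) (i : I) → ⨅ f ≽ f i
    ⨅-great  : ∀ {I : Set c} (f : I → Cmd) (x : Cmd) → (∀ i → x ≽ f i) → x ≽ ⨅ f
    _⊓_      : Cmd → Cmd → Cmd
    ⊓-lowerˡ : ∀ x y → (x ⊓ y) ≽ x
    ⊓-lowerʳ : ∀ x y → (x ⊓ y) ≽ y
    ⊓-great  : ∀ x y z → z ≽ x → z ≽ y → z ≽ (x ⊓ y)
    _⊔c_     : Cmd → Cmd → Cmd
    ⊔-upperˡ : ∀ x y → x ≽ (x ⊔c y)
    ⊔-upperʳ : ∀ x y → y ≽ (x ⊔c y)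
    ⊔-least  : ∀ x y z → x ≽ z → y ≽ z → (x ⊔c y) ≽ z
    ⊓-distrib-⊔ : ∀ x y z → (x ⊓ (y ⊔c z)) ≡ ((x ⊓ y) ⊔c (x ⊓ z))
    _；_      : Cmd → Cmd → Cmd
    nil      : Cmd
    ；-assoc  : ∀ x y z → (x ； y) ； z ≡ x ； (y ； z)
    ；-identityˡ : ∀ x → nil ； x ≡ x
    ；-identityʳ : ∀ x → x ； nil ≡ x
    ；-distribʳ-⨅ : ∀ {I : Set c} (x : Cmd) (f : I → Cmd) → x ； ⨅ f ≡ ⨅ (λ i → x ； f i)
    -- ; distributes over non-empty choices on the left
    ；-distribˡ-⨅ : ∀ {I : Set c} (f : I → Cmd) (x : Cmd) → I → (⨅ f) ； x ≡ ⨅ (λ i → f i ； x)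
    ；-distribʳ-⊓ : ∀ x y z → x ； (y ⊓ z) ≡ (x ； y) ⊓ (x ； z)
    ；-distribˡ-⊓ : ∀ x y z → (x ⊓ y) ； z ≡ (x ； z) ⊓ (y ； z)
    Atomic   : Cmd → Set c
    _⊗_      : Cmd → Cmd → Cmd
    ⊗-assoc  : ∀ x y z → (x ⊗ y) ⊗ z ≡ x ⊗ (y ⊗ z)
    ⊗-comm   : ∀ x y → x ⊗ y ≡ y ⊗ x
    ⊗-distrib-⨅ : ∀ {I : Set c} (f : I → Cmd) (x : Cmd) → I → (⨅ f) ⊗ x ≡ ⨅ (λ i → f i ⊗ x)
    ⊗-distrib-⊓ : ∀ x y z → (x ⊓ y) ⊗ z ≡ (x ⊗ z) ⊓ (y ⊗ z)
    ⊗-atomic : ∀ a b → Atomic a → Atomic b → Atomic (a ⊗ b)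
    -- finite iteration  c⋆ = νx. nil ⊓ c;x  (greatest fixed point)
    _⋆       : Cmd → Cmd
    ⋆-unfold : ∀ x → x ⋆ ≡ nil ⊓ (x ； (x ⋆))
    ⋆-induct : ∀ x y → y ≽ (nil ⊓ (x ； y)) → y ≽ (x ⋆)
    ⊗-interchange : ∀ a b x y → Atomic a → Atomic b →
                    (a ； x) ⊗ (b ； y) ≡ (a ⊗ b) ； (x ⊗ y)

-- Unfolding a⋆ ; c and b⋆ ; d together, both sides advance in lock-step by
-- a ⊗ b until one iteration stops, leaving c ⊗ (b⋆ ; d) or (a⋆ ; c) ⊗ d.  So
-- the left-hand side refines to that choice and to (a ⊗ b) ; itself, and
-- iteration induction gives one refinement.  Conversely, the right-hand side
-- refines every (aⁱ ; c) ⊗ (bʲ ; d) by induction on i and j, and the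
-- left-hand side is the infimum of these since ⊗ distributes over non-empty
-- choices.
module Submission where

open import Defs
open import Level using (Level; Lift; lift; lower)
open import Relation.Binary.PropositionalEquality using (_≡_; refl; sym; trans; cong; cong₂; isEquivalence)
open import Relation.Binary.Bundles using (Preorder)
open import Data.Nat using (ℕ; zero; suc)

module Properties {ℓ : Level} (A : CommandAlgebra ℓ) where
  open CommandAlgebra A

  ≽-reflexive : ∀ {x y} → x ≡ y → x ≽ y
  ≽-reflexive refl = ≽-refl

  ≽-preorder : Preorder ℓ ℓ ℓ
  ≽-preorder = record
    { Carrier    = Cmd
    ; _≈_        = _≡_
    ; _≲_        = _≽_
    ; isPreorder = record
      { isEquivalence = isEquivalence
      ; reflexive     = ≽-reflexive
      ; trans         = ≽-trans
      }
    }

  open import Relation.Binary.Reasoning.Preorder ≽-preorder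

  ≽⇒≡⊓ : ∀ {x y} → x ≽ y → x ≡ (x ⊓ y)
  ≽⇒≡⊓ {x} {y} x≽y = ≽-antisym (⊓-great x y x ≽-refl x≽y) (⊓-lowerˡ x y)

  ；-monoʳ-≽ : ∀ z {x y} → x ≽ y → (z ； x) ≽ (z ； y)
  ；-monoʳ-≽ z {x} {y} x≽y = begin
    z ； x            ≡⟨ cong (z ；_) (≽⇒≡⊓ x≽y) ⟩
    z ； (x ⊓ y)      ≡⟨ ；-distribʳ-⊓ z x y ⟩
    z ； x ⊓ z ； y   ∼⟨ ⊓-lowerʳ _ _ ⟩
    z ； y            ∎

  ⊗-monoˡ-≽ : ∀ z {x y} → x ≽ y → (x ⊗ z) ≽ (y ⊗ z)
  ⊗-monoˡ-≽ z {x} {y} x≽y = begin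
    x ⊗ z             ≡⟨ cong (_⊗ z) (≽⇒≡⊓ x≽y) ⟩
    (x ⊓ y) ⊗ z       ≡⟨ ⊗-distrib-⊓ x y z ⟩
    x ⊗ z ⊓ y ⊗ z     ∼⟨ ⊓-lowerʳ _ _ ⟩
    y ⊗ z             ∎

  ⊗-monoʳ-≽ : ∀ z {x y} → x ≽ y → (z ⊗ x) ≽ (z ⊗ y)
  ⊗-monoʳ-≽ z {x} {y} x≽y = begin
    z ⊗ x   ≡⟨ ⊗-comm z x ⟩
    x ⊗ z   ∼⟨ ⊗-monoˡ-≽ z x≽y ⟩
    y ⊗ z   ≡⟨ ⊗-comm y z ⟩
    z ⊗ y   ∎

  ≽-⨅⊗ : ∀ {I : Set ℓ} (f : I → Cmd) (x y : Cmd) → I →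
          (∀ i → y ≽ (f i ⊗ x)) → y ≽ (⨅ f ⊗ x)
  ≽-⨅⊗ f x y i₀ y≽fx = begin
    y                      ∼⟨ ⨅-great _ y y≽fx ⟩
    ⨅ (λ i → f i ⊗ x)     ≡⟨ sym (⊗-distrib-⨅ f x i₀) ⟩
    ⨅ f ⊗ x               ∎

  ≽-⨅⊗⨅ : ∀ {I J : Set ℓ} (f : I → Cmd) (g : J → Cmd) (y : Cmd) → I → J →
           (∀ i j → y ≽ (f i ⊗ g j)) → y ≽ (⨅ f ⊗ ⨅ g)
  ≽-⨅⊗⨅ f g y i₀ j₀ y≽fg = ≽-⨅⊗ f (⨅ g) y i₀ λ i → begin
    y            ∼⟨ ≽-⨅⊗ g (f i) y j₀ (λ j → ≽-trans (y≽fg i j) (≽-reflexive (⊗-comm _ _))) ⟩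
    ⨅ g ⊗ f i   ≡⟨ ⊗-comm _ _ ⟩
    f i ⊗ ⨅ g   ∎

  infixr 8 _^_
  _^_ : Cmd → ℕ → Cmd
  x ^ zero  = nil
  x ^ suc n = x ； x ^ n

  ⋆≽^ : ∀ x n → (x ⋆) ≽ (x ^ n)
  ⋆≽^ x zero = begin
    x ⋆                  ≡⟨ ⋆-unfold x ⟩
    nil ⊓ x ； x ⋆       ∼⟨ ⊓-lowerˡ _ _ ⟩
    nil                  ∎
  ⋆≽^ x (suc n) = begin
    x ⋆                  ≡⟨ ⋆-unfold x ⟩
    nil ⊓ x ； x ⋆       ∼⟨ ⊓-lowerʳ _ _ ⟩
    x ； x ⋆             ∼⟨ ；-monoʳ-≽ x (⋆≽^ x n) ⟩
    x ； x ^ n           ∎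

  -- ℕ is lifted to the level of the index sets of ⨅.
  powers : Cmd → Lift ℓ ℕ → Cmd
  powers x n = x ^ lower n

  ⋆≡⨅powers : ∀ x → x ⋆ ≡ ⨅ (powers x)
  ⋆≡⨅powers x = ≽-antisym (⨅-great (powers x) (x ⋆) (λ n → ⋆≽^ x (lower n)))
    (⋆-induct x (⨅ (powers x)) (⊓-great _ _ _ (⨅-lower (powers x) (lift 0)) (begin
      ⨅ (powers x)                ∼⟨ ⨅-great _ _ (λ n → ⨅-lower (powers x) (lift (suc (lower n)))) ⟩
      ⨅ (λ n → x ； powers x n)   ≡⟨ sym (；-distribʳ-⨅ x (powers x)) ⟩
      x ； ⨅ (powers x)           ∎)))

  ⋆；≡⨅powers； : ∀ x z → (x ⋆) ； z ≡ ⨅ (λ n → powers x n ； z)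
  ⋆；≡⨅powers； x z = trans (cong (_； z) (⋆≡⨅powers x)) (；-distribˡ-⨅ (powers x) z (lift 0))

  ⋆；-unfold : ∀ x z → (x ⋆) ； z ≡ z ⊓ x ； ((x ⋆) ； z)
  ⋆；-unfold x z = begin-equality
    x ⋆ ； z                    ≡⟨ cong (_； z) (⋆-unfold x) ⟩
    (nil ⊓ x ； x ⋆) ； z       ≡⟨ ；-distribˡ-⊓ nil (x ； x ⋆) z ⟩
    nil ； z ⊓ (x ； x ⋆) ； z  ≡⟨ cong₂ _⊓_ (；-identityˡ z) (；-assoc x (x ⋆) z) ⟩
    z ⊓ x ； (x ⋆ ； z)         ∎

  ⋆；-lowerˡ : ∀ x z → ((x ⋆) ； z) ≽ z
  ⋆；-lowerˡ x z = ≽-trans (≽-reflexive (⋆；-unfold x z)) (⊓-lowerˡ _ _)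

  ⋆；-lowerʳ : ∀ x z → ((x ⋆) ； z) ≽ (x ； ((x ⋆) ； z))
  ⋆；-lowerʳ x z = ≽-trans (≽-reflexive (⋆；-unfold x z)) (⊓-lowerʳ _ _)

  ⋆；-induct : ∀ x z y → y ≽ z → y ≽ (x ； y) → y ≽ ((x ⋆) ； z)
  ⋆；-induct x z y y≽z y≽xy = begin
    y                           ∼⟨ ⨅-great _ y (λ n → ≽^； (lower n)) ⟩
    ⨅ (λ n → powers x n ； z)   ≡⟨ sym (⋆；≡⨅powers； x z) ⟩
    x ⋆ ； z                    ∎
    where
    ≽^； : ∀ n → y ≽ (x ^ n ； z)
    ≽^； zero = begin
      y           ∼⟨ y≽z ⟩
      z           ≡⟨ sym (；-identityˡ z) ⟩
      nil ； z    ∎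
    ≽^； (suc n) = begin
      y                    ∼⟨ y≽xy ⟩
      x ； y               ∼⟨ ；-monoʳ-≽ x (≽^； n) ⟩
      x ； (x ^ n ； z)    ≡⟨ sym (；-assoc x (x ^ n) z) ⟩
      (x ； x ^ n) ； z    ∎

  ⋆；≽^； : ∀ x z n → ((x ⋆) ； z) ≽ (x ^ n ； z)
  ⋆；≽^； x z n = ≽-trans (≽-reflexive (⋆；≡⨅powers； x z)) (⨅-lower _ (lift n))

  module Interleaving (a b c d : Cmd) (atomic-a : Atomic a) (atomic-b : Atomic b) where

    stopped : Cmd
    stopped = (c ⊗ ((b ⋆) ； d)) ⊓ (((a ⋆) ； c) ⊗ d)

    lhs rhs : Cmd
    lhs = ((a ⋆) ； c) ⊗ ((b ⋆) ； d)
    rhs = ((a ⊗ b) ⋆) ； stopped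

    lhs≽stopped : lhs ≽ stopped
    lhs≽stopped = ⊓-great _ _ _ (⊗-monoˡ-≽ _ (⋆；-lowerˡ a c)) (⊗-monoʳ-≽ _ (⋆；-lowerˡ b d))

    lhs≽⊗；lhs : lhs ≽ ((a ⊗ b) ； lhs)
    lhs≽⊗；lhs = begin
      ((a ⋆) ； c) ⊗ ((b ⋆) ； d)                ∼⟨ ⊗-monoˡ-≽ _ (⋆；-lowerʳ a c) ⟩
      (a ； (a ⋆) ； c) ⊗ ((b ⋆) ； d)           ∼⟨ ⊗-monoʳ-≽ _ (⋆；-lowerʳ b d) ⟩
      (a ； (a ⋆) ； c) ⊗ (b ； (b ⋆) ； d)      ≡⟨ ⊗-interchange a b _ _ atomic-a atomic-b ⟩
      (a ⊗ b) ； lhs                             ∎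

    lhs≽rhs : lhs ≽ rhs
    lhs≽rhs = ⋆；-induct (a ⊗ b) stopped lhs lhs≽stopped lhs≽⊗；lhs

    rhs≽^；⊗^； : ∀ i j → rhs ≽ ((a ^ i ； c) ⊗ (b ^ j ； d))
    rhs≽^；⊗^； zero j = begin
      rhs                        ∼⟨ ⋆；-lowerˡ _ stopped ⟩
      stopped                    ∼⟨ ⊓-lowerˡ _ _ ⟩
      c ⊗ ((b ⋆) ； d)           ∼⟨ ⊗-monoʳ-≽ c (⋆；≽^； b d j) ⟩
      c ⊗ (b ^ j ； d)           ≡⟨ cong (_⊗ (b ^ j ； d)) (sym (；-identityˡ c)) ⟩
      (nil ； c) ⊗ (b ^ j ； d)  ∎
    rhs≽^；⊗^； (suc i) zero = begin
      rhs                              ∼⟨ ⋆；-lowerˡ _ stopped ⟩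
      stopped                          ∼⟨ ⊓-lowerʳ _ _ ⟩
      ((a ⋆) ； c) ⊗ d                 ∼⟨ ⊗-monoˡ-≽ d (⋆；≽^； a c (suc i)) ⟩
      (a ^ suc i ； c) ⊗ d             ≡⟨ cong ((a ^ suc i ； c) ⊗_) (sym (；-identityˡ d)) ⟩
      (a ^ suc i ； c) ⊗ (nil ； d)    ∎
    rhs≽^；⊗^； (suc i) (suc j) = begin
      rhs                                          ∼⟨ ⋆；-lowerʳ _ stopped ⟩
      (a ⊗ b) ； rhs                               ∼⟨ ；-monoʳ-≽ (a ⊗ b) (rhs≽^；⊗^； i j) ⟩
      (a ⊗ b) ； ((a ^ i ； c) ⊗ (b ^ j ； d))     ≡⟨ sym (⊗-interchange a b _ _ atomic-a atomic-b) ⟩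
      (a ； a ^ i ； c) ⊗ (b ； b ^ j ； d)        ≡⟨ sym (cong₂ _⊗_ (；-assoc a (a ^ i) c) (；-assoc b (b ^ j) d)) ⟩
      (a ^ suc i ； c) ⊗ (b ^ suc j ； d)          ∎

    rhs≽lhs : rhs ≽ lhs
    rhs≽lhs = begin
      rhs
        ∼⟨ ≽-⨅⊗⨅ _ _ rhs (lift 0) (lift 0) (λ i j → rhs≽^；⊗^； (lower i) (lower j)) ⟩
      ⨅ (λ i → powers a i ； c) ⊗ ⨅ (λ j → powers b j ； d)
        ≡⟨ sym (cong₂ _⊗_ (⋆；≡⨅powers； a c) (⋆；≡⨅powers； b d)) ⟩
      lhs ∎

mainTheorem7 : ∀ {ℓ : Level} (A : CommandAlgebra ℓ) → let open CommandAlgebra A in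
                 ∀ (a b c d : Cmd) → Atomic a → Atomic b →
                 ((a ⋆) ； c) ⊗ ((b ⋆) ； d)
                   ≡ ((a ⊗ b) ⋆) ； ((c ⊗ ((b ⋆) ； d)) ⊓ (((a ⋆) ； c) ⊗ d))
mainTheorem7 A a b c d atomic-a atomic-b = ≽-antisym lhs≽rhs rhs≽lhs
  where
  open CommandAlgebra A using (≽-antisym)
  open Properties.Interleaving A a b c d atomic-a atomic-b
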